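{- Let $S$ be a set. For every reduction $\mathcal{J}$, every saturation $\mathcal{A}$, and every basic topology $[\mathcal{A}',\mathcal{J}']$ on $S$: $$[\mathbb{A}(\mathcal{J}),\mathcal{J}]\leq[\mathcal{A}',\mathcal{J}']\iff\mathcal{J}\subseteq\mathcal{J}'\qquad\text{and}\qquad \mathcal{A}'\supseteq\mathcal{A}\iff[\mathcal{A}',\mathcal{J}']\leq[\mathcal{A},\mathbb{J}(\mathcal{A})].$$ That is, with $I_R(\mathcal{J})=[\mathbb{A}(\mathcal{J}),\mathcal{J}]$, $U_R([\mathcal{A},\mathcal{J}])=\mathcal{J}$, $I_S(\mathcal{A})=[\mathcal{A},\mathbb{J}(\mathcal{A})]$, $U_S([\mathcal{A},\mathcal{J}])=\mathcal{A}$, one has $I_R\dashv U_R$ between the reductions on $S$ ordered by $\subseteq$ and the poset of basic topologies on $S$, and $U_S\dashv I_S$ between the poset of basic topologies on $S$ and the saturations on $S$ ordered by $\supseteq$.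
   Context: All reasoning is intuitionistic (no law of excluded middle); impredicative constructions allowed. An operator on $S$ is a map $\mathrm{Pow}(S)\to\mathrm{Pow}(S)$, ordered pointwise by inclusion $\subseteq$. For $U,V\subseteq S$, $U\between V$ means there exists $a\in U\cap V$. $\mathcal{O}\triangleleft\mathcal{O}'$ means: for all $U,V\subseteq S$, $\mathcal{O}(U)\between\mathcal{O}'(V)$ implies $U\between\mathcal{O}'(V)$. A saturation is a monotone idempotent operator $\mathcal{A}$ with $U\subseteq\mathcal{A}(U)$ for all $U$; a reduction is a monotone idempotent operator $\mathcal{J}$ with $\mathcal{J}(U)\subseteq U$ for all $U$. For a reduction $\mathcal{J}$, $\mathbb{A}(\mathcal{J})$ is the greatest saturation $\mathcal{A}$ with $\mathcal{A}\triangleleft\mathcal{J}$; for a saturation $\mathcal{A}$, $\mathbb{J}(\mathcal{A})$ is the greatest reduction $\mathcal{J}$ with $\mathcal{A}\triangleleft\mathcal{J}$ (both exist). A basic topology on $S$ is a pair $[\mathcal{A},\mathcal{J}]$ with $\mathcal{A}$ a saturation, $\mathcal{J}$ a reduction and $\mathcal{A}\triangleleft\mathcal{J}$. Basic topologies are partially ordered by $[\mathcal{A}_1,\mathcal{J}_1]\leq[\mathcal{A}_2,\mathcal{J}_2]$ iff $\mathcal{A}_2\subseteq\mathcal{A}_1$ and $\mathcal{J}_1\subseteq\mathcal{J}_2$. -}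

module Defs where

open import Level using (Level; suc)
open import Data.Product using (_×_)
open import Relation.Unary using (Pred; _⊆_; _≬_)

Op : {ℓ : Level} → Set ℓ → Set (suc ℓ)
Op {ℓ} S = Pred S ℓ → Pred S ℓ

module _ {ℓ : Level} {S : Set ℓ} where

  _⊑_ : Op S → Op S → Set (suc ℓ)
  O ⊑ O′ = ∀ U → O U ⊆ O′ U

  _◁_ : Op S → Op S → Set (suc ℓ)
  O ◁ O′ = ∀ U V → O U ≬ O′ V → U ≬ O′ V

  Monotone : Op S → Set (suc ℓ)
  Monotone O = ∀ {U V} → U ⊆ V → O U ⊆ O V

  Idempotent : Op S → Set (suc ℓ)
  Idempotent O = ∀ U → (O (O U) ⊆ O U) × (O U ⊆ O (O U))

  IsSaturation : Op S → Set (suc ℓ)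
  IsSaturation A = Monotone A × Idempotent A × (∀ U → U ⊆ A U)

  IsReduction : Op S → Set (suc ℓ)
  IsReduction J = Monotone J × Idempotent J × (∀ U → J U ⊆ U)

  IsBasicTopology : Op S → Op S → Set (suc ℓ)
  IsBasicTopology A J = IsSaturation A × IsReduction J × (A ◁ J)

  BT≤ : Op S → Op S → Op S → Op S → Set (suc ℓ)
  BT≤ A₁ J₁ A₂ J₂ = (A₂ ⊑ A₁) × (J₁ ⊑ J₂)

  IsGreatestSaturation◁ : Op S → Op S → Set (suc ℓ)
  IsGreatestSaturation◁ J 𝔸J =
    IsSaturation 𝔸J × (𝔸J ◁ J) × (∀ A → IsSaturation A → A ◁ J → A ⊑ 𝔸J)

  IsGreatestReduction◁ : Op S → Op S → Set (suc ℓ)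
  IsGreatestReduction◁ A 𝕁A =
    IsReduction 𝕁A × (A ◁ 𝕁A) × (∀ J → IsReduction J → A ◁ J → J ⊑ 𝕁A)

-- Both adjunctions come down to two ways of transporting the relation ◁ along
-- inclusions: a smaller saturation is still compatible with the same reduction,
-- and a saturation compatible with J′ is compatible with any idempotent J ⊑ J′.
-- With these, each adjunction is the universal property of 𝔸(J), resp. 𝕁(A).
module Submission where

open import Defs
open import Level using (Level)
open import Data.Product using (_×_; _,_; proj₁; proj₂; map₂; map)
open import Function.Base using (id)
open import Function.Bundles using (_⇔_; mk⇔)
open import Relation.Unary using (Pred; _⊆_; _≬_)

module _ {ℓ : Level} {S : Set ℓ} where

  ≬-mono : {P P′ Q Q′ : Pred S ℓ} → P ⊆ P′ → Q ⊆ Q′ → P ≬ Q → P′ ≬ Q′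
  ≬-mono P⊆P′ Q⊆Q′ = map₂ (map P⊆P′ Q⊆Q′)

  ⊑-◁-trans : {A A′ J : Op S} → A ⊑ A′ → A′ ◁ J → A ◁ J
  ⊑-◁-trans A⊑A′ A′◁J U V AU≬JV = A′◁J U V (≬-mono (A⊑A′ U) id AU≬JV)

  -- Apply A ◁ J′ to the subset J V, which J fixes: J V ⊆ J (J V) ⊆ J′ (J V) ⊆ J V.
  ◁-⊑-trans : {A J J′ : Op S} → Idempotent J → (∀ U → J′ U ⊆ U) →
              J ⊑ J′ → A ◁ J′ → A ◁ J
  ◁-⊑-trans {J = J} idemJ deflJ′ J⊑J′ A◁J′ U V AU≬JV =
    ≬-mono id (deflJ′ (J V))
      (A◁J′ U (J V) (≬-mono id (λ j → J⊑J′ (J V) (proj₂ (idemJ V) j)) AU≬JV))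

  greatestSaturation◁-leftAdjoint : {J A′ J′ 𝔸J : Op S} → IsReduction J →
    IsBasicTopology A′ J′ → IsGreatestSaturation◁ J 𝔸J →
    BT≤ 𝔸J J A′ J′ ⇔ (J ⊑ J′)
  greatestSaturation◁-leftAdjoint {A′ = A′} (_ , idemJ , _)
    (satA′ , (_ , _ , deflJ′) , A′◁J′) (_ , _ , 𝔸J-greatest) =
    mk⇔ proj₂ λ J⊑J′ →
      𝔸J-greatest A′ satA′ (◁-⊑-trans idemJ deflJ′ J⊑J′ A′◁J′) , J⊑J′

  greatestReduction◁-rightAdjoint : {A A′ J′ 𝕁A : Op S} →
    IsBasicTopology A′ J′ → IsGreatestReduction◁ A 𝕁A →
    (A ⊑ A′) ⇔ BT≤ A′ J′ A 𝕁A
  greatestReduction◁-rightAdjoint {J′ = J′} (_ , redJ′ , A′◁J′) (_ , _ , 𝕁A-greatest) =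
    mk⇔ (λ A⊑A′ → A⊑A′ , 𝕁A-greatest J′ redJ′ (⊑-◁-trans A⊑A′ A′◁J′)) proj₁

proposition3p4 : {ℓ : Level} {S : Set ℓ} (J A A′ J′ 𝔸J 𝕁A : Op S) →
    IsReduction J → IsSaturation A → IsBasicTopology A′ J′ →
    IsGreatestSaturation◁ J 𝔸J → IsGreatestReduction◁ A 𝕁A →
    (BT≤ 𝔸J J A′ J′ ⇔ (J ⊑ J′)) × ((A ⊑ A′) ⇔ BT≤ A′ J′ A 𝕁A)
proposition3p4 J A A′ J′ 𝔸J 𝕁A redJ _ bt 𝔸J-greatest 𝕁A-greatest =
  greatestSaturation◁-leftAdjoint redJ bt 𝔸J-greatest ,
  greatestReduction◁-rightAdjoint bt 𝕁A-greatest
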